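{- For each $n<\omega$ and all $A,B\in\mathcal{F}^\nabla_n$, at least one of the following holds: $A\vdash\Diamond_nB$ is provable in $\mathrm{RC}^\nabla$; $B\vdash\Diamond_nA$ is provable in $\mathrm{RC}^\nabla$; or $\nabla_nA=\nabla_nB$ is provable in $\mathrm{RC}^\nabla$.
   Context: Strictly positive formulas are built from propositional variables and $\top$ by $\land$ and unary modalities $\Diamond_n,\nabla_n$ ($n<\omega$). $\mathcal{F}^\nabla_n$ is the set of variable-free strictly positive formulas using only modalities $\Diamond_i,\nabla_i$ with $i\ge n$. $\mathrm{RC}^\nabla$ is the smallest set of sequents $A\vdash B$ containing the following axioms and closed under the following rules and under substitution: (1) $A\vdash A$; $A\vdash\top$; $A\land B\vdash A$; $A\land B\vdash B$; from $A\vdash B$, $B\vdash C$ infer $A\vdash C$; from $A\vdash B$, $A\vdash C$ infer $A\vdash B\land C$; from $A\vdash B$ infer $aA\vdash aB$ for each modality $a$; (2) $aaA\vdash aA$ for each modality $a$; (3) for $m<n$: $\Diamond_nA\vdash\Diamond_mA$, $\Diamond_nA\land\Diamond_mB\vdash\Diamond_n(A\land\Diamond_mB)$, and the same two with $\nabla$ in place of $\Diamond$; (4) $A\vdash\nabla_nA$, $\Diamond_nA\vdash\nabla_nA$; (5) for $m\le n$: $\Diamond_m\nabla_nA\vdash\Diamond_mA$, $\nabla_n\Diamond_mA\vdash\Diamond_mA$. $X=Y$ means provability of $X\vdash Y$ and $Y\vdash X$. -}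

module Defs where

open import Data.Nat using (ℕ; _<_; _≤_)
open import Data.Product using (_×_)

data Fm : Set where
  var : ℕ → Fm
  ⊤   : Fm
  _∧_ : Fm → Fm → Fm
  ◇   : ℕ → Fm → Fm
  ∇   : ℕ → Fm → Fm

infixr 6 _∧_

data Mod : Set where
  dia : ℕ → Mod
  nab : ℕ → Mod

app : Mod → Fm → Fm
app (dia n) A = ◇ n A
app (nab n) A = ∇ n A

subst : (ℕ → Fm) → Fm → Fm
subst σ (var x) = σ x
subst σ ⊤ = ⊤
subst σ (A ∧ B) = subst σ A ∧ subst σ B
subst σ (◇ n A) = ◇ n (subst σ A)
subst σ (∇ n A) = ∇ n (subst σ A)

infix 4 _⊢_
data _⊢_ : Fm → Fm → Set where
  refl⊢  : ∀ {A} → A ⊢ A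
  top    : ∀ {A} → A ⊢ ⊤
  ∧E₁    : ∀ {A B} → A ∧ B ⊢ A
  ∧E₂    : ∀ {A B} → A ∧ B ⊢ B
  cut    : ∀ {A B C} → A ⊢ B → B ⊢ C → A ⊢ C
  ∧I     : ∀ {A B C} → A ⊢ B → A ⊢ C → A ⊢ B ∧ C
  mono   : ∀ {A B} (a : Mod) → A ⊢ B → app a A ⊢ app a B
  trans4 : ∀ {A} (a : Mod) → app a (app a A) ⊢ app a A
  ◇mon   : ∀ {m n A} → m < n → ◇ n A ⊢ ◇ m A
  ◇J     : ∀ {m n A B} → m < n → ◇ n A ∧ ◇ m B ⊢ ◇ n (A ∧ ◇ m B)
  ∇mon   : ∀ {m n A} → m < n → ∇ n A ⊢ ∇ m A
  ∇J     : ∀ {m n A B} → m < n → ∇ n A ∧ ∇ m B ⊢ ∇ n (A ∧ ∇ m B)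
  ∇refl  : ∀ {n A} → A ⊢ ∇ n A
  ◇∇     : ∀ {n A} → ◇ n A ⊢ ∇ n A
  ◇∇◇    : ∀ {m n A} → m ≤ n → ◇ m (∇ n A) ⊢ ◇ m A
  ∇◇◇    : ∀ {m n A} → m ≤ n → ∇ n (◇ m A) ⊢ ◇ m A
  sub    : ∀ {A B} (σ : ℕ → Fm) → A ⊢ B → subst σ A ⊢ subst σ B

infix 4 _≣_
_≣_ : Fm → Fm → Set
A ≣ B = (A ⊢ B) × (B ⊢ A)

data F∇ (n : ℕ) : Fm → Set where
  ⊤∈ : F∇ n ⊤
  ∧∈ : ∀ {A B} → F∇ n A → F∇ n B → F∇ n (A ∧ B)
  ◇∈ : ∀ {i A} → n ≤ i → F∇ n A → F∇ n (◇ i A)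
  ∇∈ : ∀ {i A} → n ≤ i → F∇ n A → F∇ n (∇ i A)

-- The proof is by induction on a weighted size in which a modality of index i
-- counts i ∸ n. Every A ∈ F∇ n is equivalent to a ∧ L with a ∈ F∇ (n + 1) and
-- L one of ⊤, ◇ n c, ∇ n c: the level-n conjuncts of a conjunction are
-- ⊢-comparable by the induction hypothesis, so one of them absorbs the other.
-- Up to ∇ n-equivalence a conjunct ∇ n c can be removed: splitting c ∼ e ∧ L'
-- and comparing a with e at level n + 1, either a ⊢ ◇ (n + 1) e, and then
-- ∇ n c may be replaced by ◇ n c, or e ⊢ ∇ (n + 1) a, and then A ∼ e ∧ L'.
-- Finally, for A ∼ a ∧ La and B ∼ b ∧ Lb with La, Lb free of ∇ n, one compares
-- A with Lb and B with La at level n, and then the heads a and b at level n + 1,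
-- where they are strictly smaller unless both are provable from ⊤.
module Submission where

open import Defs
open import Data.Nat using (ℕ; suc; _+_; _∸_; _<_; _≤_; z≤n; s≤s)
open import Data.Nat.Properties
open import Data.Nat.Induction using (<-wellFounded)
open import Data.Product using (_×_; _,_; proj₁; proj₂)
open import Data.Sum using (_⊎_; inj₁; inj₂; [_,_]′; map₂)
open import Induction.WellFounded using (Acc; acc)
open import Relation.Binary.PropositionalEquality using (_≡_; refl)
open import Algebra.Properties.CommutativeSemigroup +-commutativeSemigroup using (interchange)

infixl 5 _⨾_
_⨾_ : ∀ {A B C} → A ⊢ B → B ⊢ C → A ⊢ C
_⨾_ = cut

∧-mono : ∀ {A A′ B B′} → A ⊢ A′ → B ⊢ B′ → A ∧ B ⊢ A′ ∧ B′
∧-mono p q = ∧I (∧E₁ ⨾ p) (∧E₂ ⨾ q)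

∧-interchange : ∀ {A B C D} → (A ∧ B) ∧ (C ∧ D) ⊢ (A ∧ C) ∧ (B ∧ D)
∧-interchange = ∧I (∧-mono ∧E₁ ∧E₁) (∧-mono ∧E₂ ∧E₂)

≣-trans : ∀ {A B C} → A ≣ B → B ≣ C → A ≣ C
≣-trans (p , q) (r , s) = p ⨾ r , s ⨾ q

mono-≣ : ∀ {A B} (a : Mod) → A ≣ B → app a A ≣ app a B
mono-≣ a (p , q) = mono a p , mono a q

∧-regroup : ∀ {A a L B b M K} → A ≣ a ∧ L → B ≣ b ∧ M → L ∧ M ≣ K → A ∧ B ≣ (a ∧ b) ∧ K
∧-regroup (p , p′) (q , q′) (k , k′) =
  ∧-mono p q ⨾ ∧-interchange ⨾ ∧-mono refl⊢ k , ∧-mono refl⊢ k′ ⨾ ∧-interchange ⨾ ∧-mono p′ q′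

infix 4 _~[_]_
_~[_]_ : Fm → ℕ → Fm → Set
A ~[ n ] B = (A ⊢ ∇ n B) × (B ⊢ ∇ n A)

≣⇒~ : ∀ {n A B} → A ≣ B → A ~[ n ] B
≣⇒~ (p , q) = p ⨾ ∇refl , q ⨾ ∇refl

~⇒∇≣ : ∀ {n A B} → A ~[ n ] B → ∇ n A ≣ ∇ n B
~⇒∇≣ {n} (p , q) = mono (nab n) p ⨾ trans4 (nab n) , mono (nab n) q ⨾ trans4 (nab n)

Comparable : ℕ → Fm → Fm → Set
Comparable n A B = (A ⊢ ◇ n B) ⊎ ((B ⊢ ◇ n A) ⊎ (A ~[ n ] B))

∇-Closed : ℕ → Fm → Set
∇-Closed n Z = ∇ n Z ⊢ Z

⊢-via-∇ : ∀ {n X Y Z} → ∇-Closed n Z → X ⊢ ∇ n Y → Y ⊢ Z → X ⊢ Z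
⊢-via-∇ {n} closed p q = p ⨾ mono (nab n) q ⨾ closed

∇-∧-closed : ∀ {n i X Z} → n < i → ∇-Closed n Z → ∇ i X ∧ Z ⊢ ∇ i (X ∧ Z)
∇-∧-closed {i = i} n<i closed = ∧-mono refl⊢ ∇refl ⨾ ∇J n<i ⨾ mono (nab i) (∧-mono refl⊢ closed)

∇-distrib-closed : ∀ {n i X Z} → n < i → ∇-Closed n Z → ∇ i (X ∧ Z) ≣ ∇ i X ∧ Z
∇-distrib-closed {i = i} n<i closed =
  ∧I (mono (nab i) ∧E₁) (mono (nab i) ∧E₂ ⨾ ∇mon n<i ⨾ closed) , ∇-∧-closed n<i closed

∇-suc-∧ : ∀ {n X Z} → ∇-Closed n Z → ∇ (suc n) X ∧ Z ⊢ ∇ n (X ∧ Z)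
∇-suc-∧ {n} closed = ∇-∧-closed (n<1+n n) closed ⨾ ∇mon (n<1+n n)

-- Weighted size at level n: a modality of index i weighs i ∸ n, so moving a
-- formula of F∇ (suc n) from level n to level suc n shrinks it strictly unless
-- it is built from ⊤ and ∧ alone.
size : ℕ → Fm → ℕ
size n (var _) = 1
size n ⊤ = 1
size n (A ∧ B) = suc (size n A + size n B)
size n (◇ i A) = suc (i ∸ n + size n A)
size n (∇ i A) = suc (i ∸ n + size n A)

size-pos : ∀ n A → 0 < size n A
size-pos n (var _) = s≤s z≤n
size-pos n ⊤ = s≤s z≤n
size-pos n (_ ∧ _) = s≤s z≤n
size-pos n (◇ _ _) = s≤s z≤n
size-pos n (∇ _ _) = s≤s z≤n

summand-< : ∀ n a {k m} → size n a + k ≤ m → k < m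
summand-< n a {k} h = <-≤-trans (m<n+m k (size-pos n a)) h

weight-< : ∀ {n i} → suc n ≤ i → i ∸ suc n < i ∸ n
weight-< = ∸-monoʳ-< (n<1+n _)

size-suc-≤ : ∀ {n X} → F∇ (suc n) X → size (suc n) X ≤ size n X
size-suc-≤ ⊤∈ = ≤-refl
size-suc-≤ (∧∈ p q) = s≤s (+-mono-≤ (size-suc-≤ p) (size-suc-≤ q))
size-suc-≤ (◇∈ i≥ p) = s≤s (+-mono-≤ (<⇒≤ (weight-< i≥)) (size-suc-≤ p))
size-suc-≤ (∇∈ i≥ p) = s≤s (+-mono-≤ (<⇒≤ (weight-< i≥)) (size-suc-≤ p))

size-suc-< : ∀ {n X} → F∇ (suc n) X → (⊤ ⊢ X) ⊎ (size (suc n) X < size n X)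
size-suc-< ⊤∈ = inj₁ refl⊢
size-suc-< (∧∈ p q) with size-suc-< p | size-suc-< q
... | inj₁ ⊤⊢A | inj₁ ⊤⊢B = inj₁ (∧I ⊤⊢A ⊤⊢B)
... | inj₂ A< | _ = inj₂ (s≤s (+-mono-<-≤ A< (size-suc-≤ q)))
... | inj₁ _ | inj₂ B< = inj₂ (s≤s (+-mono-≤-< (size-suc-≤ p) B<))
size-suc-< (◇∈ i≥ p) = inj₂ (s≤s (+-mono-<-≤ (weight-< i≥) (size-suc-≤ p)))
size-suc-< (∇∈ i≥ p) = inj₂ (s≤s (+-mono-<-≤ (weight-< i≥) (size-suc-≤ p)))

modal-size : ∀ x {a b C} → a + b ≤ C → suc (x + a) + b ≤ suc (x + C)
modal-size x {a} {b} h = s≤s (≤-trans (≤-reflexive (+-assoc x a b)) (+-monoʳ-≤ x h))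

conj-size : ∀ a b c d {e C D} → a + c ≤ C → b + d ≤ D → e ≤ c + d → suc (a + b) + e ≤ suc (C + D)
conj-size a b c d hC hD he =
  s≤s (≤-trans (+-monoʳ-≤ (a + b) he) (≤-trans (≤-reflexive (interchange a b c d)) (+-mono-≤ hC hD)))

ComparableBelow : ℕ → Set
ComparableBelow s = ∀ {m A B} → F∇ m A → F∇ m B → size m A + size m B < s → Comparable m A B

below-mono : ∀ {s t} → s ≤ t → ComparableBelow t → ComparableBelow s
below-mono s≤t cmp pA pB lt = cmp pA pB (<-≤-trans lt s≤t)

compare-heads : ∀ {s n a b} → ComparableBelow s → F∇ (suc n) a → F∇ (suc n) b →
  size n a + size n b ≤ s → Comparable (suc n) a b
compare-heads cmp pa pb le with size-suc-< (∧∈ pa pb)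
... | inj₁ ⊤⊢a∧b = inj₂ (inj₂ (top ⨾ ⊤⊢a∧b ⨾ ∧E₂ ⨾ ∇refl , top ⨾ ⊤⊢a∧b ⨾ ∧E₁ ⨾ ∇refl))
... | inj₂ (s≤s lt) = cmp pa pb (<-≤-trans lt le)

data Kind : Set where
  ◇ₖ ∇ₖ : Kind

modality : Kind → ℕ → Mod
modality ◇ₖ = dia
modality ∇ₖ = nab

⟨_⟩ : Kind → ℕ → Fm → Fm
⟨ κ ⟩ n = app (modality κ n)

◇⊢⟨⟩ : ∀ κ {n X} → ◇ n X ⊢ ⟨ κ ⟩ n X
◇⊢⟨⟩ ◇ₖ = refl⊢
◇⊢⟨⟩ ∇ₖ = ◇∇

⟨⟩-◇-absorb : ∀ κ {n X} → ⟨ κ ⟩ n (◇ n X) ⊢ ◇ n X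
⟨⟩-◇-absorb ◇ₖ = trans4 (dia _)
⟨⟩-◇-absorb ∇ₖ = ∇◇◇ ≤-refl

⟨⟩-∇-absorb : ∀ κ {n X} → ⟨ κ ⟩ n (∇ n X) ⊢ ⟨ κ ⟩ n X
⟨⟩-∇-absorb ◇ₖ = ◇∇◇ ≤-refl
⟨⟩-∇-absorb ∇ₖ = trans4 (nab _)

◇-⟨⟩-absorb : ∀ κ {n X} → ◇ n (⟨ κ ⟩ n X) ⊢ ◇ n X
◇-⟨⟩-absorb ◇ₖ = trans4 (dia _)
◇-⟨⟩-absorb ∇ₖ = ◇∇◇ ≤-refl

⟨⟩-via-◇ : ∀ κ κ′ {n c d} → c ⊢ ◇ n d → ⟨ κ ⟩ n c ⊢ ⟨ κ′ ⟩ n d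
⟨⟩-via-◇ κ κ′ {n} p = mono (modality κ n) p ⨾ ⟨⟩-◇-absorb κ ⨾ ◇⊢⟨⟩ κ′

⟨⟩-via-∇ : ∀ κ {n c d} → c ⊢ ∇ n d → ⟨ κ ⟩ n c ⊢ ⟨ κ ⟩ n d
⟨⟩-via-∇ κ {n} p = mono (modality κ n) p ⨾ ⟨⟩-∇-absorb κ

⟨⟩-total : ∀ κ κ′ {n c d} → Comparable n c d → (⟨ κ ⟩ n c ⊢ ⟨ κ′ ⟩ n d) ⊎ (⟨ κ′ ⟩ n d ⊢ ⟨ κ ⟩ n c)
⟨⟩-total κ κ′ (inj₁ c⊢◇d) = inj₁ (⟨⟩-via-◇ κ κ′ c⊢◇d)
⟨⟩-total κ κ′ (inj₂ (inj₁ d⊢◇c)) = inj₂ (⟨⟩-via-◇ κ′ κ d⊢◇c)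
⟨⟩-total ◇ₖ κ′ (inj₂ (inj₂ (c⊢∇d , _))) = inj₁ (⟨⟩-via-∇ ◇ₖ c⊢∇d ⨾ ◇⊢⟨⟩ κ′)
⟨⟩-total ∇ₖ ◇ₖ (inj₂ (inj₂ (_ , d⊢∇c))) = inj₂ (⟨⟩-via-∇ ◇ₖ d⊢∇c ⨾ ◇∇)
⟨⟩-total ∇ₖ ∇ₖ (inj₂ (inj₂ (c⊢∇d , _))) = inj₁ (⟨⟩-via-∇ ∇ₖ c⊢∇d)

-- The conjunct ⊤, ◇ n c or ∇ n c that collects the modalities of index exactly n.
data Low (n : ℕ) : Set where
  none : Low n
  some : Kind → (c : Fm) → F∇ n c → Low n

⟦_⟧ : ∀ {n} → Low n → Fm
⟦ none ⟧ = ⊤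
⟦_⟧ {n} (some κ c _) = ⟨ κ ⟩ n c

lowSize : ∀ {n} → Low n → ℕ
lowSize none = 0
lowSize {n} (some _ c _) = size n c

data ∇-Free {n} : Low n → Set where
  none : ∇-Free none
  ◇ₗ : ∀ {c} (p : F∇ n c) → ∇-Free (some ◇ₖ c p)

toDiamond : ∀ {n} → Low n → Low n
toDiamond none = none
toDiamond (some _ c p) = some ◇ₖ c p

lowSize-toDiamond : ∀ {n} (L : Low n) → lowSize (toDiamond L) ≡ lowSize L
lowSize-toDiamond none = refl
lowSize-toDiamond (some _ _ _) = refl

∇-closed-low : ∀ {n} (L : Low n) → ∇-Closed n ⟦ L ⟧
∇-closed-low none = top
∇-closed-low (some ◇ₖ _ _) = ∇◇◇ ≤-refl
∇-closed-low (some ∇ₖ _ _) = trans4 (nab _)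

low-of-~ : ∀ {n A a} (L : Low n) → A ~[ n ] a ∧ ⟦ L ⟧ → A ⊢ ⟦ L ⟧
low-of-~ L A~ = ⊢-via-∇ (∇-closed-low L) (proj₁ A~) ∧E₂

◇-distrib-low : ∀ {n i X} → n < i → (L : Low n) → ◇ i (X ∧ ⟦ L ⟧) ≣ ◇ i X ∧ ⟦ toDiamond L ⟧
◇-distrib-low {i = i} n<i none = ∧I (mono (dia i) ∧E₁) top , ∧E₁ ⨾ mono (dia i) (∧I refl⊢ top)
◇-distrib-low {i = i} n<i (some κ _ _) =
  ∧I (mono (dia i) ∧E₁) (mono (dia i) ∧E₂ ⨾ ◇mon n<i ⨾ ◇-⟨⟩-absorb κ) ,
  ◇J n<i ⨾ mono (dia i) (∧-mono refl⊢ (◇⊢⟨⟩ κ))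

◇-suc-∧ : ∀ {n X} {L : Low n} → ∇-Free L → ◇ (suc n) X ∧ ⟦ L ⟧ ⊢ ◇ n (X ∧ ⟦ L ⟧)
◇-suc-∧ {n} none = ∧E₁ ⨾ ◇mon (n<1+n n) ⨾ mono (dia n) (∧I refl⊢ top)
◇-suc-∧ {n} (◇ₗ _) = ◇J (n<1+n n) ⨾ ◇mon (n<1+n n)

◇-below : ∀ {n A a} {L : Low n} → ∇-Free L → A ~[ n ] a ∧ ⟦ L ⟧ → ◇ (suc n) a ∧ ⟦ L ⟧ ⊢ ◇ n A
◇-below {n} free A~ = ◇-suc-∧ free ⨾ mono (dia n) (proj₂ A~) ⨾ ◇∇◇ ≤-refl

∇-below : ∀ {n A a} (L : Low n) → A ~[ n ] a ∧ ⟦ L ⟧ → ∇ (suc n) a ∧ ⟦ L ⟧ ⊢ ∇ n A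
∇-below {n} L A~ = ∇-suc-∧ (∇-closed-low L) ⨾ mono (nab n) (proj₂ A~) ⨾ trans4 (nab n)

low-total : ∀ {s n} → ComparableBelow s → (L M : Low n) → lowSize L + lowSize M < s →
  (⟦ L ⟧ ⊢ ⟦ M ⟧) ⊎ (⟦ M ⟧ ⊢ ⟦ L ⟧)
low-total cmp none M _ = inj₂ top
low-total cmp (some κ c pc) none _ = inj₁ top
low-total cmp (some κ c pc) (some κ′ d pd) lt = ⟨⟩-total κ κ′ (cmp pc pd lt)

record Split (n : ℕ) (A : Fm) : Set where
  constructor splitting
  field
    high : Fm
    high∈ : F∇ (suc n) high
    low : Low n
    split-≣ : A ≣ high ∧ ⟦ low ⟧
    split-size : size n high + lowSize low ≤ size n A

split-top : ∀ {n} κ {C} → F∇ n C → Split n (⟨ κ ⟩ n C)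
split-top ◇ₖ pC = splitting ⊤ ⊤∈ (some ◇ₖ _ pC) (∧I top refl⊢ , ∧E₂) (s≤s (m≤n+m _ _))
split-top ∇ₖ pC = splitting ⊤ ⊤∈ (some ∇ₖ _ pC) (∧I top refl⊢ , ∧E₂) (s≤s (m≤n+m _ _))

split-◇ : ∀ {n i C} → n < i → Split n C → Split n (◇ i C)
split-◇ {n} {i} n<i (splitting c c∈ L C≣ sz) =
  splitting (◇ i c) (◇∈ n<i c∈) (toDiamond L)
    (≣-trans (mono-≣ (dia i) C≣) (◇-distrib-low n<i L))
    (modal-size (i ∸ n) (≤-trans (+-monoʳ-≤ (size n c) (≤-reflexive (lowSize-toDiamond L))) sz))

split-∇ : ∀ {n i C} → n < i → Split n C → Split n (∇ i C)
split-∇ {n} {i} n<i (splitting c c∈ L C≣ sz) =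
  splitting (∇ i c) (∇∈ n<i c∈) L
    (≣-trans (mono-≣ (nab i) C≣) (∇-distrib-closed n<i (∇-closed-low L)))
    (modal-size (i ∸ n) sz)

split-∧ : ∀ {n C D} → ComparableBelow (size n (C ∧ D)) → Split n C → Split n D → Split n (C ∧ D)
split-∧ {n} {C} {D} cmp (splitting c c∈ Lc C≣ szC) (splitting d d∈ Ld D≣ szD) =
  [ (λ Lc⊢Ld → splitting (c ∧ d) (∧∈ c∈ d∈) Lc (∧-regroup C≣ D≣ (∧E₁ , ∧I refl⊢ Lc⊢Ld)) (size-≤ (m≤m+n _ _)))
  , (λ Ld⊢Lc → splitting (c ∧ d) (∧∈ c∈ d∈) Ld (∧-regroup C≣ D≣ (∧E₂ , ∧I Ld⊢Lc refl⊢)) (size-≤ (m≤n+m _ _)))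
  ]′ (low-total cmp Lc Ld (s≤s (+-mono-≤ (m+n≤o⇒n≤o (size n c) szC) (m+n≤o⇒n≤o (size n d) szD))))
  where
  size-≤ : ∀ {e} → e ≤ lowSize Lc + lowSize Ld → size n (c ∧ d) + e ≤ size n (C ∧ D)
  size-≤ = conj-size (size n c) (size n d) (lowSize Lc) (lowSize Ld) szC szD

split : ∀ {n A} → ComparableBelow (size n A) → F∇ n A → Split n A
split cmp ⊤∈ = splitting ⊤ ⊤∈ none (∧I refl⊢ top , ∧E₁) ≤-refl
split cmp (∧∈ pC pD) =
  split-∧ cmp (split (below-mono (m≤n⇒m≤1+n (m≤m+n _ _)) cmp) pC)
              (split (below-mono (m≤n⇒m≤1+n (m≤n+m _ _)) cmp) pD)
split cmp (◇∈ n≤i pC) with m≤n⇒m<n∨m≡n n≤i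
... | inj₁ n<i = split-◇ n<i (split (below-mono (m≤n⇒m≤1+n (m≤n+m _ _)) cmp) pC)
... | inj₂ refl = split-top ◇ₖ pC
split cmp (∇∈ n≤i pC) with m≤n⇒m<n∨m≡n n≤i
... | inj₁ n<i = split-∇ n<i (split (below-mono (m≤n⇒m≤1+n (m≤n+m _ _)) cmp) pC)
... | inj₂ refl = split-top ∇ₖ pC

record ∇-Split (n : ℕ) (A : Fm) : Set where
  constructor ∇-splitting
  field
    high : Fm
    high∈ : F∇ (suc n) high
    low : Low n
    low-free : ∇-Free low
    split-~ : A ~[ n ] high ∧ ⟦ low ⟧
    split-size : size n high + lowSize low ≤ size n A

◇-conjunct : ∀ {n a c e} {L : Low n} → c ~[ n ] e ∧ ⟦ L ⟧ → ∇-Free L → a ⊢ ◇ (suc n) e →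
  a ∧ ∇ n c ≣ a ∧ ◇ n c
◇-conjunct {L = L} c~ free a⊢◇e =
  ∧I ∧E₁ (∧-mono a⊢◇e (⊢-via-∇ (∇-closed-low L) refl⊢ (low-of-~ L c~)) ⨾ ◇-below free c~) ,
  ∧-mono refl⊢ ◇∇

~-of-∇-conjunct : ∀ {n A a c e} → A ≣ a ∧ ∇ n c → c ~[ n ] e → e ⊢ ∇ (suc n) a → A ~[ n ] e
~-of-∇-conjunct {n} A≣ c~ e⊢∇a =
  ⊢-via-∇ (trans4 (nab n)) (proj₁ A≣ ⨾ ∧E₂) (proj₁ c~) ,
  ∧I e⊢∇a (proj₂ c~) ⨾ ∇-suc-∧ (trans4 (nab n)) ⨾ mono (nab n) (proj₂ A≣)

eliminate-∇ : ∀ {n A a c} → ComparableBelow (size n A) → F∇ (suc n) a → F∇ n c →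
  A ≣ a ∧ ∇ n c → size n a + size n c ≤ size n A → ∇-Split n c → ∇-Split n A
eliminate-∇ {n} {a = a} cmp a∈ pc A≣ sz (∇-splitting e e∈ L free c~ szc)
  with compare-heads cmp a∈ e∈ (≤-trans (+-monoʳ-≤ (size n a) (m+n≤o⇒m≤o (size n e) szc)) sz)
... | inj₁ a⊢◇e =
  ∇-splitting a a∈ (some ◇ₖ _ pc) (◇ₗ pc) (≣⇒~ (≣-trans A≣ (◇-conjunct c~ free a⊢◇e))) sz
... | inj₂ (inj₁ e⊢◇a) =
  ∇-splitting e e∈ L free (~-of-∇-conjunct A≣ c~ (∧E₁ ⨾ e⊢◇a ⨾ ◇∇)) (≤-trans szc (<⇒≤ (summand-< n a sz)))
... | inj₂ (inj₂ (_ , e⊢∇a)) =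
  ∇-splitting e e∈ L free (~-of-∇-conjunct A≣ c~ (∧E₁ ⨾ e⊢∇a)) (≤-trans szc (<⇒≤ (summand-< n a sz)))

∇-split : ∀ {n A} → Acc _<_ (size n A) → ComparableBelow (size n A) → F∇ n A → ∇-Split n A
∇-split {n} (acc rs) cmp pA with split cmp pA
... | splitting a a∈ none A≣ sz = ∇-splitting a a∈ none none (≣⇒~ A≣) sz
... | splitting a a∈ (some ◇ₖ c pc) A≣ sz = ∇-splitting a a∈ (some ◇ₖ c pc) (◇ₗ pc) (≣⇒~ A≣) sz
... | splitting a a∈ (some ∇ₖ c pc) A≣ sz =
  eliminate-∇ cmp a∈ pc A≣ sz
    (∇-split (rs (summand-< n a sz)) (below-mono (<⇒≤ (summand-< n a sz)) cmp) pc)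

open ∇-Split

low-< : ∀ {n A} (s : ∇-Split n A) → lowSize (low s) < size n A
low-< {n} s = summand-< n (high s) (split-size s)

high-≤ : ∀ {n A} (s : ∇-Split n A) → size n (high s) ≤ size n A
high-≤ {n} s = m+n≤o⇒m≤o (size n (high s)) (split-size s)

◇-from-heads : ∀ {n A B} (sA : ∇-Split n A) (sB : ∇-Split n B) →
  A ⊢ ⟦ low sB ⟧ → high sA ⊢ ◇ (suc n) (high sB) → A ⊢ ◇ n B
◇-from-heads sA sB A⊢Lb a⊢◇b =
  ⊢-via-∇ (∇◇◇ ≤-refl) (proj₁ (split-~ sA))
    (∧I (∧E₁ ⨾ a⊢◇b) (⊢-via-∇ (∇-closed-low (low sB)) (proj₂ (split-~ sA)) A⊢Lb)
      ⨾ ◇-below (low-free sB) (split-~ sB))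

∇-from-heads : ∀ {n A B} (sA : ∇-Split n A) (sB : ∇-Split n B) →
  A ⊢ ⟦ low sB ⟧ → high sA ⊢ ∇ (suc n) (high sB) → A ⊢ ∇ n B
∇-from-heads {n} sA sB A⊢Lb a⊢∇b =
  ⊢-via-∇ (trans4 (nab n)) (proj₁ (split-~ sA))
    (∧I (∧E₁ ⨾ a⊢∇b) (⊢-via-∇ (∇-closed-low (low sB)) (proj₂ (split-~ sA)) A⊢Lb)
      ⨾ ∇-below (low sB) (split-~ sB))

comparable-from-heads : ∀ {n A B} (sA : ∇-Split n A) (sB : ∇-Split n B) →
  A ⊢ ⟦ low sB ⟧ → B ⊢ ⟦ low sA ⟧ → Comparable (suc n) (high sA) (high sB) → Comparable n A B
comparable-from-heads sA sB A⊢Lb B⊢La (inj₁ a⊢◇b) = inj₁ (◇-from-heads sA sB A⊢Lb a⊢◇b)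
comparable-from-heads sA sB A⊢Lb B⊢La (inj₂ (inj₁ b⊢◇a)) = inj₂ (inj₁ (◇-from-heads sB sA B⊢La b⊢◇a))
comparable-from-heads sA sB A⊢Lb B⊢La (inj₂ (inj₂ (a⊢∇b , b⊢∇a))) =
  inj₂ (inj₂ (∇-from-heads sA sB A⊢Lb a⊢∇b , ∇-from-heads sB sA B⊢La b⊢∇a))

versus-low : ∀ {s n A B b} {L : Low n} → ComparableBelow s → F∇ n A → B ~[ n ] b ∧ ⟦ L ⟧ →
  ∇-Free L → size n A + lowSize L < s → (B ⊢ ◇ n A) ⊎ (A ⊢ ⟦ L ⟧)
versus-low cmp pA B~ none lt = inj₂ top
versus-low cmp pA B~ (◇ₗ pc) lt with cmp pA pc lt
... | inj₁ A⊢◇c = inj₂ A⊢◇c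
... | inj₂ (inj₁ c⊢◇A) = inj₁ (low-of-~ (some ◇ₖ _ pc) B~ ⨾ ⟨⟩-via-◇ ◇ₖ ◇ₖ c⊢◇A)
... | inj₂ (inj₂ (_ , c⊢∇A)) = inj₁ (low-of-~ (some ◇ₖ _ pc) B~ ⨾ ⟨⟩-via-∇ ◇ₖ c⊢∇A)

comparable-step : ∀ {n A B} → ComparableBelow (size n A + size n B) → F∇ n A → F∇ n B → Comparable n A B
comparable-step {n} {A} {B} cmp pA pB
  with ∇-split (<-wellFounded _) (below-mono (m≤m+n _ _) cmp) pA
     | ∇-split (<-wellFounded _) (below-mono (m≤n+m _ _) cmp) pB
... | sA | sB
  with versus-low cmp pA (split-~ sB) (low-free sB) (+-monoʳ-< (size n A) (low-< sB))
     | versus-low cmp pB (split-~ sA) (low-free sA)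
         (<-≤-trans (+-monoʳ-< (size n B) (low-< sA)) (≤-reflexive (+-comm (size n B) (size n A))))
... | inj₁ B⊢◇A | _ = inj₂ (inj₁ B⊢◇A)
... | inj₂ _ | inj₁ A⊢◇B = inj₁ A⊢◇B
... | inj₂ A⊢Lb | inj₂ B⊢La =
  comparable-from-heads sA sB A⊢Lb B⊢La
    (compare-heads cmp (high∈ sA) (high∈ sB) (+-mono-≤ (high-≤ sA) (high-≤ sB)))

comparable : ∀ {n A B} → Acc _<_ (size n A + size n B) → F∇ n A → F∇ n B → Comparable n A B
comparable (acc rs) = comparable-step (λ pA pB lt → comparable (rs lt) pA pB)

corollary3 : (n : ℕ) (A B : Fm) → F∇ n A → F∇ n B →
    (A ⊢ ◇ n B) ⊎ ((B ⊢ ◇ n A) ⊎ (∇ n A ≣ ∇ n B))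
corollary3 n A B pA pB = map₂ (map₂ ~⇒∇≣) (comparable (<-wellFounded _) pA pB)
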